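{- Let $Q$ be finite with rank function $\rho$ and maximal rank $m$, with types, models $\mathcal{D}^k$ and type interpretation $[\![\cdot]\!]^k$ as in the context. For every simple type $A$, every $S\subseteq\mathcal{T}_A$ and every $k\le m$: $[\![S]\!]^k=[\![S\cap\mathcal{T}^k_A]\!]^k$; and, if $k<m$, $[\![S\cap\mathcal{T}^k_A]\!]^{k+1}=([\![S]\!]^k)^{\uparrow\bot}$ and $[\![S]\!]^k=([\![S]\!]^{k+1})^\downarrow$.
   Context: $Q_k=\{q:\rho(q)=k\}$, $Q_{\le k}=\{q:\rho(q)\le k\}$. Intersection types: $\tau^k_o=Q_k$, $\tau^k_{A\to B}=\{T\to s: T\subseteq\mathcal{T}^k_A, s\in\tau^k_B\}$, $\mathcal{T}^k_A=\bigcup_{l\le k}\tau^l_A$, $\mathcal{T}_A=\mathcal{T}^m_A$. Models: $\mathcal{D}^0_o=\mathcal{P}(Q_0)$, $\mathcal{D}^0_{A\to B}$ = monotone maps; for $k>0$: $\mathcal{D}^k_o=\mathcal{P}(Q_{\le k})$, $\mathcal{L}^k_o=\{(R,P): R=P\cap Q_{\le k-1}\}$, $\mathcal{L}^k_{A\to B}=\{(f_1,f_2): f_1\in\mathcal{D}^{k-1}_{A\to B}$, $f_2$ monotone $\mathcal{D}^k_A\to\mathcal{D}^k_B$, $(f_1(g_1),f_2(g_2))\in\mathcal{L}^k_B$ whenever $(g_1,g_2)\in\mathcal{L}^k_A\}$, $\mathcal{D}^k_{A\to B}=\{f_2:\exists f_1,(f_1,f_2)\in\mathcal{L}^k_{A\to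 B}\}$; order inclusion/pointwise; $\bot^k_A$ least element. $e^\downarrow$ is the unique $d$ with $(d,e)\in\mathcal{L}^{k}_A$; $d^{\uparrow\bot}$ is the least $e$ with $(d,e)\in\mathcal{L}^{k}_A$. Step function in $\mathcal{D}^k$: $(d\Rightarrow e)(h)=e$ if $d\le h$, else $\bot^k_B$. Type interpretation in $\mathcal{D}^k$: $[\![q]\!]^k=\{q\}$ if $\rho(q)\le k$, $\emptyset$ otherwise; $[\![S]\!]^k=\bigvee\{[\![t]\!]^k:t\in S\}$; $[\![T\to s]\!]^k=[\![T]\!]^k\Rightarrow[\![s]\!]^k$. -}

module Defs where

-- Conventions:
--  * Q = Fin n, rank function ρ : Fin n → ℕ.
--  * Subsets of Q are Vec Bool n (characteristic vectors).
--  * Semantic carriers are finite: an element of the carrier for A ⇒ B is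
--    the full graph (table) of a function from the carrier of A to that of B,
--    indexed by a complete enumeration of the carrier of A.  The model
--    D^k_A is then a (decidable, Bool-valued) predicate on this carrier, and
--    the order / equality of D^k are the paper's ones (pointwise on D^k_A).
--  * Finite sets of intersection types are represented by lists.

open import Data.Nat using (ℕ; zero; suc; _^_; _≤ᵇ_; _≡ᵇ_)
open import Data.Bool using (Bool; true; false; _∧_; _∨_; not; if_then_else_)
open import Data.Fin using (Fin; _≟_)
open import Data.Vec using (Vec; []; _∷_; map; concat; lookup; tabulate;
  replicate; zipWith; allFin; foldr′)
open import Data.Vec.Membership.Propositional using (_∈_)
open import Data.Vec.Membership.Propositional.Properties
  using (∈-map⁺; ∈-++⁺ˡ; ∈-++⁺ʳ)
open import Data.Vec.Relation.Unary.Any using (here; there; index)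
open import Data.List using (List; []; _∷_; filterᵇ)
open import Relation.Binary.PropositionalEquality using (_≡_; refl)
open import Relation.Nullary.Decidable using (⌊_⌋)
open import Data.Product using (_×_)

infixr 5 _⇒_
data Ty : Set where
  o   : Ty
  _⇒_ : Ty → Ty → Ty

allV : ∀ {a} {X : Set a} {l} → (X → Bool) → Vec X l → Bool
allV p xs = foldr′ (λ x b → p x ∧ b) true xs

anyV : ∀ {a} {X : Set a} {l} → (X → Bool) → Vec X l → Bool
anyV p xs = foldr′ (λ x b → p x ∨ b) false xs

allVecs : ∀ {X : Set} {s} → Vec X s → (l : ℕ) → Vec (Vec X l) (s ^ l)
allVecs xs zero    = [] ∷ []
allVecs xs (suc l) = concat (map (λ x → map (x ∷_) (allVecs xs l)) xs)

allVecs-complete : ∀ {X : Set} {s} (xs : Vec X s) → (∀ x → x ∈ xs) →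
                   ∀ l (v : Vec X l) → v ∈ allVecs xs l
allVecs-complete xs c zero [] = here refl
allVecs-complete {X} xs c (suc l) (y ∷ ys) = go xs (c y)
  where
  go : ∀ {s'} (zs : Vec X s') → y ∈ zs →
       (y ∷ ys) ∈ concat (map (λ x → map (x ∷_) (allVecs xs l)) zs)
  go (z ∷ zs) (here refl) = ∈-++⁺ˡ (∈-map⁺ (y ∷_) (allVecs-complete xs c l ys))
  go (z ∷ zs) (there p)   = ∈-++⁺ʳ (map (z ∷_) (allVecs xs l)) (go zs p)

module Model (n : ℕ) (ρ : Fin n → ℕ) where

  size : Ty → ℕ
  size o       = 2 ^ n
  size (A ⇒ B) = size B ^ size A

  El : Ty → Set
  El o       = Vec Bool n
  El (A ⇒ B) = Vec (El B) (size A)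

  bools : Vec Bool 2
  bools = false ∷ true ∷ []

  bools-complete : ∀ b → b ∈ bools
  bools-complete false = here refl
  bools-complete true  = there (here refl)

  enum : (A : Ty) → Vec (El A) (size A)
  enum o       = allVecs bools n
  enum (A ⇒ B) = allVecs (enum B) (size A)

  complete : (A : Ty) (x : El A) → x ∈ enum A
  complete o       x = allVecs-complete bools bools-complete n x
  complete (A ⇒ B) f = allVecs-complete (enum B) (complete B) (size A) f

  app : ∀ {A B} → El (A ⇒ B) → El A → El B
  app {A} f x = lookup f (index (complete A x))

  tab : ∀ {A B} → (El A → El B) → El (A ⇒ B)
  tab {A} g = map g (enum A)

  bot : (A : Ty) → El A
  bot o       = replicate n false
  bot (A ⇒ B) = replicate (size A) (bot B)

  join : (A : Ty) → El A → El A → El A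
  join o       x y = zipWith _∨_ x y
  join (A ⇒ B) f g = zipWith (join B) f g

  allQ : (Fin n → Bool) → Bool
  allQ p = allV p (allFin n)

  _⟹_ : Bool → Bool → Bool
  a ⟹ b = not a ∨ b

  -- Models D^k (membership inD k A), their order (leq k A), and the
  -- logical relation  Lr k A d e  :=  (d , e) ∈ L^{k+1}_A .
  mutual
    inD : ℕ → (A : Ty) → El A → Bool
    inD k o x             = allQ (λ q → lookup x q ⟹ (ρ q ≤ᵇ k))
    inD zero (A ⇒ B) f    = mono zero A B f
    inD (suc k) (A ⇒ B) f = anyV (λ f₁ → Lr k (A ⇒ B) f₁ f) (enum (A ⇒ B))

    mono : ℕ → (A B : Ty) → El (A ⇒ B) → Bool
    mono k A B f =
      allV (λ x → inD k A x ⟹ inD k B (app {A} {B} f x)) (enum A) ∧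
      allV (λ x → allV (λ y →
        (inD k A x ∧ inD k A y ∧ leq k A x y) ⟹
          leq k B (app {A} {B} f x) (app {A} {B} f y)) (enum A)) (enum A)

    leq : ℕ → (A : Ty) → El A → El A → Bool
    leq k o x y       = allQ (λ q → lookup x q ⟹ lookup y q)
    leq k (A ⇒ B) f g =
      allV (λ x → inD k A x ⟹ leq k B (app {A} {B} f x) (app {A} {B} g x)) (enum A)

    Lr : ℕ → (A : Ty) → El A → El A → Bool
    Lr k o R P =
      inD k o R ∧ inD (suc k) o P ∧
      allQ (λ q → eqB (lookup R q) (lookup P q ∧ (ρ q ≤ᵇ k)))
      where
      eqB : Bool → Bool → Bool
      eqB a b = (a ⟹ b) ∧ (b ⟹ a)
    Lr k (A ⇒ B) f₁ f₂ =
      inD k (A ⇒ B) f₁ ∧ mono (suc k) A B f₂ ∧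
      allV (λ g₁ → allV (λ g₂ →
        Lr k A g₁ g₂ ⟹ Lr k B (app {A} {B} f₁ g₁) (app {A} {B} f₂ g₂))
        (enum A)) (enum A)

  eqD : ℕ → (A : Ty) → El A → El A → Bool
  eqD k A x y = leq k A x y ∧ leq k A y x

  step : ℕ → (A B : Ty) → El A → El B → El (A ⇒ B)
  step k A B d e = tab {A} {B} (λ h → if leq k A d h then e else bot B)

  data IT : Ty → Set where
    st  : Fin n → IT o
    arr : ∀ {A B} → List (IT A) → IT B → IT (A ⇒ B)

  mutual
    inτ : ∀ {A} → ℕ → IT A → Bool
    inτ k (st q)    = ρ q ≡ᵇ k
    inτ k (arr T s) = inTs k T ∧ inτ k s

    inTs : ∀ {A} → ℕ → List (IT A) → Bool
    inTs k []      = true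
    inTs k (t ∷ T) = inT k t ∧ inTs k T

    inT : ∀ {A} → ℕ → IT A → Bool
    inT zero    t = inτ zero t
    inT (suc k) t = inτ (suc k) t ∨ inT k t

  cap : ∀ {A} → ℕ → List (IT A) → List (IT A)
  cap k S = filterᵇ (inT k) S

  mutual
    ⟦_⟧ : ∀ {A} → IT A → ℕ → El A
    ⟦ st q ⟧ k = tabulate (λ i → ⌊ i ≟ q ⌋ ∧ (ρ q ≤ᵇ k))
    ⟦ arr {A} {B} T s ⟧ k = step k A B (⟦ T ⟧s k) (⟦ s ⟧ k)

    ⟦_⟧s : ∀ {A} → List (IT A) → ℕ → El A
    ⟦_⟧s {A} [] k      = bot A
    ⟦_⟧s {A} (t ∷ S) k = join A (⟦ t ⟧ k) (⟦ S ⟧s k)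

  IsDown : ℕ → (A : Ty) → El A → El A → Set
  IsDown k A d e =
    (Lr k A d e ≡ true) × (∀ d' → Lr k A d' e ≡ true → eqD k A d' d ≡ true)

  IsUpBot : ℕ → (A : Ty) → El A → El A → Set
  IsUpBot k A d e =
    (Lr k A d e ≡ true) × (∀ e' → Lr k A d e' ≡ true → leq (suc k) A e e' ≡ true)

module Submission where

-- The relation L^{k+1} between D^k and D^{k+1} behaves like the graph of an
-- embedding-projection pair: every e ∈ D^{k+1} has a partner e^↓, unique up to
-- equality, and every d ∈ D^k has a least partner d^{↑⊥}; both are defined by
-- recursion on types, each conjugating by the other at arrow types.  The relation
-- contains (⊥, ⊥), is closed under joins and respects equality on both sides.
-- Interpretations are then compared by induction on intersection types: a type of
-- rank above k denotes ⊥ in D^k, which gives the first equation; a type t of rank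
-- at most k satisfies (⟦t⟧ᵏ, ⟦t⟧ᵏ⁺¹) ∈ L and ⟦t⟧ᵏ⁺¹ ≤ (⟦t⟧ᵏ)^{↑⊥}; and one of rank
-- exactly k+1 satisfies (⊥, ⟦t⟧ᵏ⁺¹) ∈ L.

open import Defs
open import Data.Bool using (Bool; true; false; _∧_; _∨_; not; if_then_else_; T)
open import Data.Bool.Properties using (∧-zeroʳ; ∧-distribʳ-∨)
open import Data.Empty using (⊥-elim)
open import Data.Fin using (Fin; _≟_)
open import Data.List using (List; []; _∷_)
open import Data.List.Relation.Unary.All as All using (All; []; _∷_)
open import Data.Nat using (ℕ; zero; suc; _≤_; _<_; _≤ᵇ_; _≡ᵇ_; z≤n; _≤?_)
open import Data.Nat.Properties
  using (≤ᵇ⇒≤; ≤⇒≤ᵇ; ≡ᵇ⇒≡; ≤-refl; ≤-trans; ≤-pred; m≤n⇒m≤1+n; m≤n⇒m<n∨m≡n; <⇒≱; ≰⇒>)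
open import Data.Product using (_×_; _,_; proj₁; proj₂; Σ; ∃)
open import Data.Sum using (_⊎_; inj₁; inj₂; [_,_]′)
open import Data.Unit using (tt)
open import Data.Vec using (Vec; []; _∷_; lookup; tabulate; allFin)
open import Data.Vec.Membership.Propositional using (_∈_)
open import Data.Vec.Membership.Propositional.Properties using (∈-allFin⁺)
open import Data.Vec.Properties using (lookup-map; lookup-zipWith; lookup-replicate; lookup∘tabulate)
open import Data.Vec.Relation.Unary.Any using (here; there; index)
open import Data.Vec.Relation.Unary.Any.Properties using (lookup-index)
open import Relation.Binary.PropositionalEquality
  using (_≡_; refl; sym; trans; cong; cong₂; subst; subst₂; module ≡-Reasoning)
open import Relation.Nullary using (yes; no)
open import Relation.Nullary.Decidable using (⌊_⌋)

∧-intro : ∀ {a b} → a ≡ true → b ≡ true → a ∧ b ≡ true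
∧-intro refl refl = refl

∧-elimˡ : ∀ {a b} → a ∧ b ≡ true → a ≡ true
∧-elimˡ {true} _ = refl

∧-elimʳ : ∀ {a b} → a ∧ b ≡ true → b ≡ true
∧-elimʳ {true} p = p

∨-introˡ : ∀ {a} b → a ≡ true → a ∨ b ≡ true
∨-introˡ b refl = refl

∨-introʳ : ∀ a {b} → b ≡ true → a ∨ b ≡ true
∨-introʳ true  _ = refl
∨-introʳ false h = h

∨-elim : ∀ {a b} → a ∨ b ≡ true → a ≡ true ⊎ b ≡ true
∨-elim {true}  _ = inj₁ refl
∨-elim {false} h = inj₂ h

⟹-intro : ∀ {a b} → (a ≡ true → b ≡ true) → not a ∨ b ≡ true
⟹-intro {false} h = refl
⟹-intro {true}  h = h refl

⟹-elim : ∀ {a b} → not a ∨ b ≡ true → a ≡ true → b ≡ true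
⟹-elim {true} h refl = h

≡true-ext : ∀ {a b} → (a ≡ true → b ≡ true) → (b ≡ true → a ≡ true) → a ≡ b
≡true-ext {false} {false} f g = refl
≡true-ext {false} {true}  f g = g refl
≡true-ext {true}  {false} f g = sym (f refl)
≡true-ext {true}  {true}  f g = refl

⟺-elim : ∀ a b → (not a ∨ b) ∧ (not b ∨ a) ≡ true → a ≡ b
⟺-elim a b h = ≡true-ext (⟹-elim (∧-elimˡ h)) (⟹-elim (∧-elimʳ {not a ∨ b} h))

⟺-intro : ∀ a b → a ≡ b → (not a ∨ b) ∧ (not b ∨ a) ≡ true
⟺-intro false .false refl = refl
⟺-intro true  .true  refl = refl

∧-absorbs-implied : ∀ a b → (a ≡ true → b ≡ true) → a ≡ a ∧ b
∧-absorbs-implied false b h = refl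
∧-absorbs-implied true  b h = sym (h refl)

≤ᵇ-true⇒≤ : ∀ m k → (m ≤ᵇ k) ≡ true → m ≤ k
≤ᵇ-true⇒≤ m k h = ≤ᵇ⇒≤ m k (subst T (sym h) tt)

≤⇒≤ᵇ-true : ∀ {m k} → m ≤ k → (m ≤ᵇ k) ≡ true
≤⇒≤ᵇ-true {m} {k} h with m ≤ᵇ k | ≤⇒≤ᵇ h
... | true | _ = refl

≤ᵇ-true-suc : ∀ m k → (m ≤ᵇ k) ≡ true → (m ≤ᵇ suc k) ≡ true
≤ᵇ-true-suc m k h = ≤⇒≤ᵇ-true (m≤n⇒m≤1+n (≤ᵇ-true⇒≤ m k h))

>⇒≤ᵇ-false : ∀ {m k} → k < m → (m ≤ᵇ k) ≡ false
>⇒≤ᵇ-false {m} {k} lt with m ≤ᵇ k in eq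
... | false = refl
... | true  = ⊥-elim (<⇒≱ lt (≤ᵇ-true⇒≤ m k eq))

≡ᵇ-true⇒≡ : ∀ m k → (m ≡ᵇ k) ≡ true → m ≡ k
≡ᵇ-true⇒≡ m k h = ≡ᵇ⇒≡ m k (subst T (sym h) tt)

allV-intro : ∀ {X : Set} {l} (p : X → Bool) (xs : Vec X l) →
             (∀ {x} → x ∈ xs → p x ≡ true) → allV p xs ≡ true
allV-intro p [] h = refl
allV-intro p (y ∷ ys) h = ∧-intro (h (here refl)) (allV-intro p ys (λ q → h (there q)))

allV-elim : ∀ {X : Set} {l} (p : X → Bool) (xs : Vec X l) → allV p xs ≡ true →
            ∀ {x} → x ∈ xs → p x ≡ true
allV-elim p (y ∷ ys) h (here refl) = ∧-elimˡ h
allV-elim p (y ∷ ys) h (there q)   = allV-elim p ys (∧-elimʳ {p y} h) q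

anyV-intro : ∀ {X : Set} {l} (p : X → Bool) (xs : Vec X l) →
             ∀ {x} → x ∈ xs → p x ≡ true → anyV p xs ≡ true
anyV-intro p (y ∷ ys) (here refl) e = ∨-introˡ _ e
anyV-intro p (y ∷ ys) (there q)   e = ∨-introʳ (p y) (anyV-intro p ys q e)

anyV-elim : ∀ {X : Set} {l} (p : X → Bool) (xs : Vec X l) →
            anyV p xs ≡ true → Σ X (λ x → p x ≡ true)
anyV-elim p (y ∷ ys) h with p y in eq
... | true  = y , eq
... | false = anyV-elim p ys h

module Semantics (n : ℕ) (ρ : Fin n → ℕ) where
  open Model n ρ public

  -- El is not injective, so applications carry their types explicitly.
  ap : ∀ A B → El (A ⇒ B) → El A → El B
  ap A B f x = app {A} {B} f x

  𝒟 : ℕ → (A : Ty) → El A → Set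
  𝒟 k A x = inD k A x ≡ true

  Le : ℕ → (A : Ty) → El A → El A → Set
  Le k A x y = leq k A x y ≡ true

  Eq : ℕ → (A : Ty) → El A → El A → Set
  Eq k A x y = Le k A x y × Le k A y x

  𝓛 : ℕ → (A : Ty) → El A → El A → Set
  𝓛 k A d e = Lr k A d e ≡ true

  Monotone : ℕ → (A B : Ty) → El (A ⇒ B) → Set
  Monotone k A B f =
    (∀ x → 𝒟 k A x → 𝒟 k B (ap A B f x)) ×
    (∀ x y → 𝒟 k A x → 𝒟 k A y → Le k A x y → Le k B (ap A B f x) (ap A B f y))

  record 𝓛ₒ (k : ℕ) (R P : El o) : Set where
    constructor 𝓛ₒ-pair
    field
      low∈𝒟  : 𝒟 k o R
      high∈𝒟 : 𝒟 (suc k) o P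
      low≡high∩ : ∀ q → lookup R q ≡ (lookup P q ∧ (ρ q ≤ᵇ k))

  record 𝓛⇒ (k : ℕ) (A B : Ty) (f₁ f₂ : El (A ⇒ B)) : Set where
    constructor 𝓛⇒-pair
    field
      low∈𝒟 : 𝒟 k (A ⇒ B) f₁
      high-monotone : Monotone (suc k) A B f₂
      app-𝓛 : ∀ g₁ g₂ → 𝓛 k A g₁ g₂ → 𝓛 k B (ap A B f₁ g₁) (ap A B f₂ g₂)

  allEl-intro : ∀ A (p : El A → Bool) → (∀ x → p x ≡ true) → allV p (enum A) ≡ true
  allEl-intro A p h = allV-intro p (enum A) (λ {x} _ → h x)

  allEl-elim : ∀ A (p : El A → Bool) → allV p (enum A) ≡ true → ∀ x → p x ≡ true
  allEl-elim A p h x = allV-elim p (enum A) h (complete A x)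

  allQ-intro : ∀ (p : Fin n → Bool) → (∀ q → p q ≡ true) → allQ p ≡ true
  allQ-intro p h = allV-intro p (allFin n) (λ {q} _ → h q)

  allQ-elim : ∀ (p : Fin n → Bool) → allQ p ≡ true → ∀ q → p q ≡ true
  allQ-elim p h q = allV-elim p (allFin n) h (∈-allFin⁺ q)

  ap-tab : ∀ A B (g : El A → El B) x → ap A B (tab {A} {B} g) x ≡ g x
  ap-tab A B g x = trans (lookup-map (index (complete A x)) g (enum A))
                         (cong g (sym (lookup-index (complete A x))))

  ap-bot : ∀ A B x → ap A B (bot (A ⇒ B)) x ≡ bot B
  ap-bot A B x = lookup-replicate (index (complete A x)) (bot B)

  ap-join : ∀ A B f g x → ap A B (join (A ⇒ B) f g) x ≡ join B (ap A B f x) (ap A B g x)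
  ap-join A B f g x = lookup-zipWith (join B) (index (complete A x)) f g

  ap-step : ∀ k A B d e h → ap A B (step k A B d e) h ≡ (if leq k A d h then e else bot B)
  ap-step k A B d e h = ap-tab A B _ h

  lookup-bot : ∀ q → lookup (bot o) q ≡ false
  lookup-bot q = lookup-replicate q false

  lookup-join : ∀ x y q → lookup (join o x y) q ≡ (lookup x q ∨ lookup y q)
  lookup-join x y q = lookup-zipWith _∨_ q x y

  𝒟ₒ-intro : ∀ k x → (∀ q → lookup x q ≡ true → (ρ q ≤ᵇ k) ≡ true) → 𝒟 k o x
  𝒟ₒ-intro k x h = allQ-intro _ (λ q → ⟹-intro (h q))

  𝒟ₒ-elim : ∀ k x → 𝒟 k o x → ∀ q → lookup x q ≡ true → (ρ q ≤ᵇ k) ≡ true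
  𝒟ₒ-elim k x h q = ⟹-elim (allQ-elim _ h q)

  Leₒ-intro : ∀ k x y → (∀ q → lookup x q ≡ true → lookup y q ≡ true) → Le k o x y
  Leₒ-intro k x y h = allQ-intro _ (λ q → ⟹-intro (h q))

  Leₒ-elim : ∀ k x y → Le k o x y → ∀ q → lookup x q ≡ true → lookup y q ≡ true
  Leₒ-elim k x y h q = ⟹-elim (allQ-elim _ h q)

  Le⇒-intro : ∀ k A B f g → (∀ x → 𝒟 k A x → Le k B (ap A B f x) (ap A B g x)) → Le k (A ⇒ B) f g
  Le⇒-intro k A B f g h = allEl-intro A _ (λ x → ⟹-intro (h x))

  Le⇒-elim : ∀ k A B f g → Le k (A ⇒ B) f g → ∀ x → 𝒟 k A x → Le k B (ap A B f x) (ap A B g x)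
  Le⇒-elim k A B f g h x dx = ⟹-elim (allEl-elim A _ h x) dx

  monotone-intro : ∀ k A B f → Monotone k A B f → mono k A B f ≡ true
  monotone-intro k A B f (pres , ord) =
    ∧-intro (allEl-intro A _ (λ x → ⟹-intro (pres x)))
            (allEl-intro A _ (λ x → allEl-intro A _ (λ y → ⟹-intro (λ c →
              ord x y (∧-elimˡ c) (∧-elimˡ (∧-elimʳ {inD k A x} c))
                      (∧-elimʳ {inD k A y} (∧-elimʳ {inD k A x} c))))))

  monotone-elim : ∀ k A B f → mono k A B f ≡ true → Monotone k A B f
  monotone-elim k A B f h =
    (λ x dx → ⟹-elim (allEl-elim A _ (∧-elimˡ h) x) dx) ,
    (λ x y dx dy le → ⟹-elim (allEl-elim A _ (allEl-elim A _ (∧-elimʳ {allV _ (enum A)} h) x) y)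
                              (∧-intro dx (∧-intro dy le)))

  𝒟suc⇒-intro : ∀ k A B f₁ f → 𝓛 k (A ⇒ B) f₁ f → 𝒟 (suc k) (A ⇒ B) f
  𝒟suc⇒-intro k A B f₁ f h = anyV-intro _ (enum (A ⇒ B)) (complete (A ⇒ B) f₁) h

  𝒟suc⇒-elim : ∀ k A B f → 𝒟 (suc k) (A ⇒ B) f → Σ (El (A ⇒ B)) (λ f₁ → 𝓛 k (A ⇒ B) f₁ f)
  𝒟suc⇒-elim k A B f h = anyV-elim _ (enum (A ⇒ B)) h

  𝓛ₒ-intro : ∀ k R P → 𝓛ₒ k R P → 𝓛 k o R P
  𝓛ₒ-intro k R P (𝓛ₒ-pair dR dP eq) = ∧-intro dR (∧-intro dP (allQ-intro _ (λ q → ⟺-intro _ _ (eq q))))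

  𝓛ₒ-elim : ∀ k R P → 𝓛 k o R P → 𝓛ₒ k R P
  𝓛ₒ-elim k R P h = 𝓛ₒ-pair (∧-elimˡ h) (∧-elimˡ (∧-elimʳ {inD k o R} h))
    (λ q → ⟺-elim _ _ (allQ-elim _ (∧-elimʳ {inD (suc k) o P} (∧-elimʳ {inD k o R} h)) q))

  𝓛⇒-intro : ∀ k A B f₁ f₂ → 𝓛⇒ k A B f₁ f₂ → 𝓛 k (A ⇒ B) f₁ f₂
  𝓛⇒-intro k A B f₁ f₂ (𝓛⇒-pair d₁ m₂ r) =
    ∧-intro d₁ (∧-intro (monotone-intro (suc k) A B f₂ m₂)
      (allEl-intro A _ (λ g₁ → allEl-intro A _ (λ g₂ → ⟹-intro (r g₁ g₂)))))

  𝓛⇒-elim : ∀ k A B f₁ f₂ → 𝓛 k (A ⇒ B) f₁ f₂ → 𝓛⇒ k A B f₁ f₂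
  𝓛⇒-elim k A B f₁ f₂ h =
    𝓛⇒-pair (∧-elimˡ h) (monotone-elim (suc k) A B f₂ (∧-elimˡ rest))
      (λ g₁ g₂ r → ⟹-elim (allEl-elim A _ (allEl-elim A _ (∧-elimʳ {mono (suc k) A B f₂} rest) g₁) g₂) r)
    where
    rest = ∧-elimʳ {inD k (A ⇒ B) f₁} h

  Le-refl : ∀ k A x → Le k A x x
  Le-refl k o x       = Leₒ-intro k x x (λ q h → h)
  Le-refl k (A ⇒ B) f = Le⇒-intro k A B f f (λ x _ → Le-refl k B (ap A B f x))

  Le-trans : ∀ k A x y z → Le k A x y → Le k A y z → Le k A x z
  Le-trans k o x y z p q = Leₒ-intro k x z (λ i h → Leₒ-elim k y z q i (Leₒ-elim k x y p i h))
  Le-trans k (A ⇒ B) f g h p q = Le⇒-intro k A B f h (λ x dx →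
    Le-trans k B _ _ _ (Le⇒-elim k A B f g p x dx) (Le⇒-elim k A B g h q x dx))

  Eq-refl : ∀ k A x → Eq k A x x
  Eq-refl k A x = Le-refl k A x , Le-refl k A x

  Eq-sym : ∀ k A x y → Eq k A x y → Eq k A y x
  Eq-sym k A x y (p , q) = q , p

  Eq-trans : ∀ k A x y z → Eq k A x y → Eq k A y z → Eq k A x z
  Eq-trans k A x y z (p , q) (p' , q') = Le-trans k A x y z p p' , Le-trans k A z y x q' q

  Eqₒ-intro : ∀ k x y → (∀ q → lookup x q ≡ lookup y q) → Eq k o x y
  Eqₒ-intro k x y h = Leₒ-intro k x y (λ q e → trans (sym (h q)) e) ,
                      Leₒ-intro k y x (λ q e → trans (h q) e)

  Eqₒ-elim : ∀ k x y → Eq k o x y → ∀ q → lookup x q ≡ lookup y q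
  Eqₒ-elim k x y (p , p') q = ≡true-ext (Leₒ-elim k x y p q) (Leₒ-elim k y x p' q)

  Eq⇒-intro : ∀ k A B f g → (∀ x → 𝒟 k A x → Eq k B (ap A B f x) (ap A B g x)) → Eq k (A ⇒ B) f g
  Eq⇒-intro k A B f g h = Le⇒-intro k A B f g (λ x dx → proj₁ (h x dx)) ,
                          Le⇒-intro k A B g f (λ x dx → proj₂ (h x dx))

  Eq⇒-elim : ∀ k A B f g → Eq k (A ⇒ B) f g → ∀ x → 𝒟 k A x → Eq k B (ap A B f x) (ap A B g x)
  Eq⇒-elim k A B f g (p , q) x dx = Le⇒-elim k A B f g p x dx , Le⇒-elim k A B g f q x dx

  𝒟⇒-monotone : ∀ k A B f → 𝒟 k (A ⇒ B) f → Monotone k A B f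
  𝒟⇒-monotone zero    A B f h = monotone-elim 0 A B f h
  𝒟⇒-monotone (suc k) A B f h = 𝓛⇒.high-monotone (𝓛⇒-elim k A B _ f (proj₂ (𝒟suc⇒-elim k A B f h)))

  𝓛⇒𝒟 : ∀ k A d e → 𝓛 k A d e → 𝒟 k A d × 𝒟 (suc k) A e
  𝓛⇒𝒟 k o d e h = 𝓛ₒ.low∈𝒟 (𝓛ₒ-elim k d e h) , 𝓛ₒ.high∈𝒟 (𝓛ₒ-elim k d e h)
  𝓛⇒𝒟 k (A ⇒ B) d e h = 𝓛⇒.low∈𝒟 (𝓛⇒-elim k A B d e h) , 𝒟suc⇒-intro k A B d e h

  Monotone-resp-Eq : ∀ k A B f g → Monotone k A B f →
                     (∀ x → 𝒟 k A x → Eq k B (ap A B f x) (ap A B g x)) →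
                     (∀ y → 𝒟 k B y → ∀ z → Eq k B y z → 𝒟 k B z) → Monotone k A B g
  Monotone-resp-Eq k A B f g (pres , ord) f≈g 𝒟-resp =
    (λ x dx → 𝒟-resp _ (pres x dx) _ (f≈g x dx)) ,
    (λ x y dx dy le → Le-trans k B _ _ _ (proj₂ (f≈g x dx))
        (Le-trans k B _ _ _ (ord x y dx dy le) (proj₁ (f≈g y dy))))

  mutual
    𝒟-resp-Eq : ∀ k A x → 𝒟 k A x → ∀ y → Eq k A x y → 𝒟 k A y
    𝒟-resp-Eq k o x dx y e = 𝒟ₒ-intro k y (λ q h → 𝒟ₒ-elim k x dx q (Leₒ-elim k y x (proj₂ e) q h))
    𝒟-resp-Eq zero (A ⇒ B) f df g e = monotone-intro 0 A B g
      (Monotone-resp-Eq 0 A B f g (monotone-elim 0 A B f df) (Eq⇒-elim 0 A B f g e) (𝒟-resp-Eq 0 B))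
    𝒟-resp-Eq (suc k) (A ⇒ B) f df g e with 𝒟suc⇒-elim k A B f df
    ... | f₁ , l with 𝓛⇒-elim k A B f₁ f l
    ... | 𝓛⇒-pair d₁ mf r = 𝒟suc⇒-intro k A B f₁ g (𝓛⇒-intro k A B f₁ g (𝓛⇒-pair d₁ mg
            (λ g₁ g₂ r₁₂ → 𝓛-respʳ-Eq k B _ _ (r g₁ g₂ r₁₂) _
               (Eq⇒-elim (suc k) A B f g e g₂ (g₂∈𝒟 r₁₂)) (proj₁ mg g₂ (g₂∈𝒟 r₁₂)))))
      where
      mg : Monotone (suc k) A B g
      mg = Monotone-resp-Eq (suc k) A B f g mf (Eq⇒-elim (suc k) A B f g e) (𝒟-resp-Eq (suc k) B)
      g₂∈𝒟 : ∀ {g₁ g₂} → 𝓛 k A g₁ g₂ → 𝒟 (suc k) A g₂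
      g₂∈𝒟 {g₁} {g₂} r₁₂ = proj₂ (𝓛⇒𝒟 k A g₁ g₂ r₁₂)

    𝓛-respʳ-Eq : ∀ k A d e → 𝓛 k A d e → ∀ e' → Eq (suc k) A e e' → 𝒟 (suc k) A e' → 𝓛 k A d e'
    𝓛-respʳ-Eq k o d e l e' eq de' with 𝓛ₒ-elim k d e l
    ... | 𝓛ₒ-pair dd _ d≡e∩ = 𝓛ₒ-intro k d e' (𝓛ₒ-pair dd de'
          (λ q → trans (d≡e∩ q) (cong (_∧ (ρ q ≤ᵇ k)) (Eqₒ-elim (suc k) e e' eq q))))
    𝓛-respʳ-Eq k (A ⇒ B) f₁ f₂ l f₂' eq df₂' with 𝓛⇒-elim k A B f₁ f₂ l
    ... | 𝓛⇒-pair d₁ _ r = 𝓛⇒-intro k A B f₁ f₂' (𝓛⇒-pair d₁ mf₂'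
          (λ g₁ g₂ r₁₂ → 𝓛-respʳ-Eq k B _ _ (r g₁ g₂ r₁₂) _
             (Eq⇒-elim (suc k) A B f₂ f₂' eq g₂ (g₂∈𝒟 r₁₂)) (proj₁ mf₂' g₂ (g₂∈𝒟 r₁₂))))
      where
      mf₂' = 𝒟⇒-monotone (suc k) A B f₂' df₂'
      g₂∈𝒟 : ∀ {g₁ g₂} → 𝓛 k A g₁ g₂ → 𝒟 (suc k) A g₂
      g₂∈𝒟 {g₁} {g₂} r₁₂ = proj₂ (𝓛⇒𝒟 k A g₁ g₂ r₁₂)

  𝓛-respˡ-Eq : ∀ k A d e → 𝓛 k A d e → ∀ d' → Eq k A d d' → 𝒟 k A d' → 𝓛 k A d' e
  𝓛-respˡ-Eq k o d e l d' eq dd' = 𝓛ₒ-intro k d' e (𝓛ₒ-pair dd' (𝓛ₒ.high∈𝒟 L)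
      (λ q → trans (sym (Eqₒ-elim k d d' eq q)) (𝓛ₒ.low≡high∩ L q)))
    where L = 𝓛ₒ-elim k d e l
  𝓛-respˡ-Eq k (A ⇒ B) d e l d' eq dd' = 𝓛⇒-intro k A B d' e (𝓛⇒-pair dd' (𝓛⇒.high-monotone L)
      (λ g₁ g₂ r → 𝓛-respˡ-Eq k B _ _ (𝓛⇒.app-𝓛 L g₁ g₂ r) (ap A B d' g₁)
          (Eq⇒-elim k A B d d' eq g₁ (g₁∈𝒟 r)) (proj₁ (𝒟⇒-monotone k A B d' dd') g₁ (g₁∈𝒟 r))))
    where
    L = 𝓛⇒-elim k A B d e l
    g₁∈𝒟 : ∀ {g₁ g₂} → 𝓛 k A g₁ g₂ → 𝒟 k A g₁
    g₁∈𝒟 {g₁} {g₂} r = proj₁ (𝓛⇒𝒟 k A g₁ g₂ r)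

  lookup-bot-absurd : ∀ q {X : Set} → lookup (bot o) q ≡ true → X
  lookup-bot-absurd q h with trans (sym (lookup-bot q)) h
  ... | ()

  bot-least : ∀ k A x → Le k A (bot A) x
  bot-least k o x = Leₒ-intro k (bot o) x (λ q h → lookup-bot-absurd q h)
  bot-least k (A ⇒ B) f = Le⇒-intro k A B (bot (A ⇒ B)) f (λ x _ →
    subst (λ z → Le k B z (ap A B f x)) (sym (ap-bot A B x)) (bot-least k B _))

  mutual
    𝒟-bot : ∀ k A → 𝒟 k A (bot A)
    𝒟-bot k o = 𝒟ₒ-intro k (bot o) (λ q h → lookup-bot-absurd q h)
    𝒟-bot zero    (A ⇒ B) = monotone-intro 0 A B (bot (A ⇒ B)) (Monotone-bot 0 A B)
    𝒟-bot (suc k) (A ⇒ B) = 𝒟suc⇒-intro k A B (bot (A ⇒ B)) (bot (A ⇒ B)) (𝓛-bot k (A ⇒ B))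

    Monotone-bot : ∀ k A B → Monotone k A B (bot (A ⇒ B))
    Monotone-bot k A B =
      (λ x _ → subst (𝒟 k B) (sym (ap-bot A B x)) (𝒟-bot k B)) ,
      (λ x y _ _ _ → subst₂ (Le k B) (sym (ap-bot A B x)) (sym (ap-bot A B y)) (Le-refl k B _))

    𝓛-bot : ∀ k A → 𝓛 k A (bot A) (bot A)
    𝓛-bot k o = 𝓛ₒ-intro k (bot o) (bot o) (𝓛ₒ-pair (𝒟-bot k o) (𝒟-bot (suc k) o)
      (λ q → trans (lookup-bot q) (sym (cong (_∧ (ρ q ≤ᵇ k)) (lookup-bot q)))))
    𝓛-bot k (A ⇒ B) = 𝓛⇒-intro k A B (bot (A ⇒ B)) (bot (A ⇒ B))
      (𝓛⇒-pair (𝒟-bot k (A ⇒ B)) (Monotone-bot (suc k) A B)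
        (λ g₁ g₂ _ → subst₂ (𝓛 k B) (sym (ap-bot A B g₁)) (sym (ap-bot A B g₂)) (𝓛-bot k B)))

  join-upperˡ : ∀ k A x y → Le k A x (join A x y)
  join-upperˡ k o x y = Leₒ-intro k x (join o x y) (λ q h → trans (lookup-join x y q) (∨-introˡ (lookup y q) h))
  join-upperˡ k (A ⇒ B) f g = Le⇒-intro k A B f (join (A ⇒ B) f g) (λ x _ →
    subst (Le k B (ap A B f x)) (sym (ap-join A B f g x)) (join-upperˡ k B _ _))

  join-upperʳ : ∀ k A x y → Le k A y (join A x y)
  join-upperʳ k o x y = Leₒ-intro k y (join o x y) (λ q h → trans (lookup-join x y q) (∨-introʳ (lookup x q) h))
  join-upperʳ k (A ⇒ B) f g = Le⇒-intro k A B g (join (A ⇒ B) f g) (λ x _ →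
    subst (Le k B (ap A B g x)) (sym (ap-join A B f g x)) (join-upperʳ k B _ _))

  join-least : ∀ k A x y z → Le k A x z → Le k A y z → Le k A (join A x y) z
  join-least k o x y z x≤z y≤z = Leₒ-intro k (join o x y) z (λ q h →
    [ Leₒ-elim k x z x≤z q , Leₒ-elim k y z y≤z q ]′ (∨-elim (trans (sym (lookup-join x y q)) h)))
  join-least k (A ⇒ B) f g h f≤h g≤h = Le⇒-intro k A B (join (A ⇒ B) f g) h (λ x dx →
    subst (λ w → Le k B w (ap A B h x)) (sym (ap-join A B f g x))
      (join-least k B _ _ _ (Le⇒-elim k A B f h f≤h x dx) (Le⇒-elim k A B g h g≤h x dx)))

  join-mono : ∀ k A x y x' y' → Le k A x x' → Le k A y y' → Le k A (join A x y) (join A x' y')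
  join-mono k A x y x' y' p q = join-least k A x y _
    (Le-trans k A _ _ _ p (join-upperˡ k A x' y')) (Le-trans k A _ _ _ q (join-upperʳ k A x' y'))

  join-cong : ∀ k A x y x' y' → Eq k A x x' → Eq k A y y' → Eq k A (join A x y) (join A x' y')
  join-cong k A x y x' y' (p , p') (q , q') = join-mono k A x y x' y' p q , join-mono k A x' y' x y p' q'

  join-identityˡ : ∀ k A x → Eq k A (join A (bot A) x) x
  join-identityˡ k A x = join-least k A (bot A) x x (bot-least k A x) (Le-refl k A x) , join-upperʳ k A (bot A) x

  mutual
    𝒟-join : ∀ k A x y → 𝒟 k A x → 𝒟 k A y → 𝒟 k A (join A x y)
    𝒟-join k o x y dx dy = 𝒟ₒ-intro k (join o x y) (λ q h →
      [ 𝒟ₒ-elim k x dx q , 𝒟ₒ-elim k y dy q ]′ (∨-elim (trans (sym (lookup-join x y q)) h)))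
    𝒟-join zero (A ⇒ B) f g df dg = monotone-intro 0 A B (join (A ⇒ B) f g)
      (Monotone-join 0 A B f g (monotone-elim 0 A B f df) (monotone-elim 0 A B g dg))
    𝒟-join (suc k) (A ⇒ B) f g df dg =
      𝒟suc⇒-intro k A B (join (A ⇒ B) (proj₁ lf) (proj₁ lg)) (join (A ⇒ B) f g)
        (𝓛-join k (A ⇒ B) (proj₁ lf) f (proj₁ lg) g (proj₂ lf) (proj₂ lg))
      where
      lf = 𝒟suc⇒-elim k A B f df
      lg = 𝒟suc⇒-elim k A B g dg

    Monotone-join : ∀ k A B f g → Monotone k A B f → Monotone k A B g → Monotone k A B (join (A ⇒ B) f g)
    Monotone-join k A B f g (pf , of) (pg , og) =
      (λ x dx → subst (𝒟 k B) (sym (ap-join A B f g x)) (𝒟-join k B _ _ (pf x dx) (pg x dx))) ,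
      (λ x y dx dy le → subst₂ (Le k B) (sym (ap-join A B f g x)) (sym (ap-join A B f g y))
         (join-mono k B _ _ _ _ (of x y dx dy le) (og x y dx dy le)))

    𝓛-join : ∀ k A d e d' e' → 𝓛 k A d e → 𝓛 k A d' e' → 𝓛 k A (join A d d') (join A e e')
    𝓛-join k o d e d' e' l l' with 𝓛ₒ-elim k d e l | 𝓛ₒ-elim k d' e' l'
    ... | 𝓛ₒ-pair dd de c | 𝓛ₒ-pair dd' de' c' =
      𝓛ₒ-intro k (join o d d') (join o e e') (𝓛ₒ-pair (𝒟-join k o d d' dd dd') (𝒟-join (suc k) o e e' de de')
        (λ q → begin
          lookup (join o d d') q                                 ≡⟨ lookup-join d d' q ⟩
          lookup d q ∨ lookup d' q                               ≡⟨ cong₂ _∨_ (c q) (c' q) ⟩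
          (lookup e q ∧ (ρ q ≤ᵇ k)) ∨ (lookup e' q ∧ (ρ q ≤ᵇ k))
            ≡⟨ ∧-distribʳ-∨ (ρ q ≤ᵇ k) (lookup e q) (lookup e' q) ⟨
          (lookup e q ∨ lookup e' q) ∧ (ρ q ≤ᵇ k)
            ≡⟨ cong (_∧ (ρ q ≤ᵇ k)) (lookup-join e e' q) ⟨
          lookup (join o e e') q ∧ (ρ q ≤ᵇ k)                    ∎))
      where open ≡-Reasoning
    𝓛-join k (A ⇒ B) d e d' e' l l' =
      𝓛⇒-intro k A B (join (A ⇒ B) d d') (join (A ⇒ B) e e')
        (𝓛⇒-pair (𝒟-join k (A ⇒ B) d d' (low∈𝒟 L) (low∈𝒟 L'))
                 (Monotone-join (suc k) A B e e' (high-monotone L) (high-monotone L'))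
          (λ g₁ g₂ r → subst₂ (𝓛 k B) (sym (ap-join A B d d' g₁)) (sym (ap-join A B e e' g₂))
             (𝓛-join k B _ _ _ _ (app-𝓛 L g₁ g₂ r) (app-𝓛 L' g₁ g₂ r))))
      where
      open 𝓛⇒
      L = 𝓛⇒-elim k A B d e l
      L' = 𝓛⇒-elim k A B d' e' l'

  Monotone-step : ∀ k A B d e → 𝒟 k B e → Monotone k A B (step k A B d e)
  Monotone-step k A B d e de = pres , ord
    where
    pres : ∀ x → 𝒟 k A x → 𝒟 k B (ap A B (step k A B d e) x)
    pres x dx rewrite ap-step k A B d e x with leq k A d x
    ... | true  = de
    ... | false = 𝒟-bot k B
    ord : ∀ x y → 𝒟 k A x → 𝒟 k A y → Le k A x y →
          Le k B (ap A B (step k A B d e) x) (ap A B (step k A B d e) y)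
    ord x y dx dy le rewrite ap-step k A B d e x | ap-step k A B d e y
      with leq k A d x in d≤x | leq k A d y in d≤y
    ... | true  | true  = Le-refl k B e
    ... | true  | false with () ← trans (sym d≤y) (Le-trans k A d x y d≤x le)
    ... | false | _     = bot-least k B _

  mutual
    up : ℕ → (A : Ty) → El A → El A
    up k o d       = d
    up k (A ⇒ B) f = tab {A} {B} (λ g → up k B (ap A B f (down k A g)))

    down : ℕ → (A : Ty) → El A → El A
    down k o e       = tabulate (λ q → lookup e q ∧ (ρ q ≤ᵇ k))
    down k (A ⇒ B) f = tab {A} {B} (λ g → down k B (ap A B f (up k A g)))

  ap-up : ∀ k A B f g → ap A B (up k (A ⇒ B) f) g ≡ up k B (ap A B f (down k A g))
  ap-up k A B f g = ap-tab A B _ g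

  ap-down : ∀ k A B f g → ap A B (down k (A ⇒ B) f) g ≡ down k B (ap A B f (up k A g))
  ap-down k A B f g = ap-tab A B _ g

  lookup-down : ∀ k e q → lookup (down k o e) q ≡ (lookup e q ∧ (ρ q ≤ᵇ k))
  lookup-down k e q = lookup∘tabulate _ q

  𝓛⇒-Eq-down : ∀ k A B f₁ f₂ → (∀ g → 𝒟 k A g → 𝓛 k A g (up k A g)) →
               (∀ d e → 𝓛 k B d e → Eq k B d (down k B e)) →
               𝓛 k (A ⇒ B) f₁ f₂ → Eq k (A ⇒ B) f₁ (down k (A ⇒ B) f₂)
  𝓛⇒-Eq-down k A B f₁ f₂ 𝓛-upA Eq-downB l = Eq⇒-intro k A B f₁ (down k (A ⇒ B) f₂) (λ g dg →
    subst (Eq k B (ap A B f₁ g)) (sym (ap-down k A B f₂ g))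
      (Eq-downB _ _ (𝓛⇒.app-𝓛 (𝓛⇒-elim k A B f₁ f₂ l) g (up k A g) (𝓛-upA g dg))))

  mutual
    𝓛-up : ∀ k A d → 𝒟 k A d → 𝓛 k A d (up k A d)
    𝓛-up k o d dd = 𝓛ₒ-intro k d d (𝓛ₒ-pair dd
      (𝒟ₒ-intro (suc k) d (λ q h → ≤ᵇ-true-suc (ρ q) k (𝒟ₒ-elim k d dd q h)))
      (λ q → ∧-absorbs-implied (lookup d q) _ (𝒟ₒ-elim k d dd q)))
    𝓛-up k (A ⇒ B) f df = 𝓛⇒-intro k A B f (up k (A ⇒ B) f) (𝓛⇒-pair df (pres , ord) rel)
      where
      M = 𝒟⇒-monotone k A B f df
      down∈𝒟 : ∀ g → 𝒟 (suc k) A g → 𝒟 k A (down k A g)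
      down∈𝒟 g dg = proj₁ (𝓛⇒𝒟 k A _ _ (𝓛-down k A g dg))
      pres : ∀ g → 𝒟 (suc k) A g → 𝒟 (suc k) B (ap A B (up k (A ⇒ B) f) g)
      pres g dg = subst (𝒟 (suc k) B) (sym (ap-up k A B f g))
        (proj₂ (𝓛⇒𝒟 k B _ _ (𝓛-up k B _ (proj₁ M (down k A g) (down∈𝒟 g dg)))))
      ord : ∀ x y → 𝒟 (suc k) A x → 𝒟 (suc k) A y → Le (suc k) A x y →
            Le (suc k) B (ap A B (up k (A ⇒ B) f) x) (ap A B (up k (A ⇒ B) f) y)
      ord x y dx dy le = subst₂ (Le (suc k) B) (sym (ap-up k A B f x)) (sym (ap-up k A B f y))
        (up-mono k B _ _ (proj₁ M _ (down∈𝒟 x dx)) (proj₁ M _ (down∈𝒟 y dy))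
          (proj₂ M _ _ (down∈𝒟 x dx) (down∈𝒟 y dy) (down-mono k A x y dx dy le)))
      rel : ∀ g₁ g₂ → 𝓛 k A g₁ g₂ → 𝓛 k B (ap A B f g₁) (ap A B (up k (A ⇒ B) f) g₂)
      rel g₁ g₂ r = subst (𝓛 k B (ap A B f g₁)) (sym (ap-up k A B f g₂))
        (𝓛-respˡ-Eq k B (ap A B f (down k A g₂)) _ (𝓛-up k B _ (proj₁ M _ dg₂↓)) (ap A B f g₁)
           (proj₂ M _ _ dg₂↓ dg₁ (proj₂ g₁≈g₂↓) , proj₂ M _ _ dg₁ dg₂↓ (proj₁ g₁≈g₂↓))
           (proj₁ M g₁ dg₁))
        where
        dg₁ = proj₁ (𝓛⇒𝒟 k A g₁ g₂ r)
        dg₂↓ = down∈𝒟 g₂ (proj₂ (𝓛⇒𝒟 k A g₁ g₂ r))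
        g₁≈g₂↓ = 𝓛⇒Eq-down k A g₁ g₂ r

    up-least : ∀ k A d e → 𝓛 k A d e → Le (suc k) A (up k A d) e
    up-least k o d e l = Leₒ-intro (suc k) d e (λ q h →
      ∧-elimˡ {lookup e q} (trans (sym (𝓛ₒ.low≡high∩ (𝓛ₒ-elim k d e l) q)) h))
    up-least k (A ⇒ B) f₁ f₂ l = Le⇒-intro (suc k) A B (up k (A ⇒ B) f₁) f₂ (λ g dg →
      subst (λ z → Le (suc k) B z (ap A B f₂ g)) (sym (ap-up k A B f₁ g))
        (up-least k B _ _ (𝓛⇒.app-𝓛 (𝓛⇒-elim k A B f₁ f₂ l) (down k A g) g (𝓛-down k A g dg))))

    𝓛-down : ∀ k A e → 𝒟 (suc k) A e → 𝓛 k A (down k A e) e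
    𝓛-down k o e de = 𝓛ₒ-intro k (down k o e) e (𝓛ₒ-pair
      (𝒟ₒ-intro k (down k o e) (λ q h → ∧-elimʳ {lookup e q} (trans (sym (lookup-down k e q)) h)))
      de (lookup-down k e))
    𝓛-down k (A ⇒ B) f₂ df₂ =
      𝓛-respˡ-Eq k (A ⇒ B) f₁ f₂ l (down k (A ⇒ B) f₂) f₁≈f₂↓
        (𝒟-resp-Eq k (A ⇒ B) f₁ (𝓛⇒.low∈𝒟 (𝓛⇒-elim k A B f₁ f₂ l))
                   (down k (A ⇒ B) f₂) f₁≈f₂↓)
      where
      f₁ = proj₁ (𝒟suc⇒-elim k A B f₂ df₂)
      l = proj₂ (𝒟suc⇒-elim k A B f₂ df₂)
      f₁≈f₂↓ = 𝓛⇒-Eq-down k A B f₁ f₂ (𝓛-up k A) (𝓛⇒Eq-down k B) l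

    𝓛⇒Eq-down : ∀ k A d e → 𝓛 k A d e → Eq k A d (down k A e)
    𝓛⇒Eq-down k o d e l = Eqₒ-intro k d (down k o e) (λ q →
      trans (𝓛ₒ.low≡high∩ (𝓛ₒ-elim k d e l) q) (sym (lookup-down k e q)))
    𝓛⇒Eq-down k (A ⇒ B) f₁ f₂ l = 𝓛⇒-Eq-down k A B f₁ f₂ (𝓛-up k A) (𝓛⇒Eq-down k B) l

    up-mono : ∀ k A d d' → 𝒟 k A d → 𝒟 k A d' → Le k A d d' → Le (suc k) A (up k A d) (up k A d')
    up-mono k o d d' _ _ le = le
    up-mono k (A ⇒ B) f f' df df' le = Le⇒-intro (suc k) A B (up k (A ⇒ B) f) (up k (A ⇒ B) f') (λ g dg →
      subst₂ (Le (suc k) B) (sym (ap-up k A B f g)) (sym (ap-up k A B f' g))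
        (up-mono k B _ _ (proj₁ (𝒟⇒-monotone k A B f df) _ (down∈𝒟 g dg))
                         (proj₁ (𝒟⇒-monotone k A B f' df') _ (down∈𝒟 g dg))
           (Le⇒-elim k A B f f' le (down k A g) (down∈𝒟 g dg))))
      where
      down∈𝒟 : ∀ g → 𝒟 (suc k) A g → 𝒟 k A (down k A g)
      down∈𝒟 g dg = proj₁ (𝓛⇒𝒟 k A _ _ (𝓛-down k A g dg))

    down-mono : ∀ k A e e' → 𝒟 (suc k) A e → 𝒟 (suc k) A e' → Le (suc k) A e e' →
                Le k A (down k A e) (down k A e')
    down-mono k o e e' _ _ le = Leₒ-intro k (down k o e) (down k o e') (λ q h →
      let h' = trans (sym (lookup-down k e q)) h in
      trans (lookup-down k e' q) (∧-intro (Leₒ-elim (suc k) e e' le q (∧-elimˡ {lookup e q} h'))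
                                          (∧-elimʳ {lookup e q} h')))
    down-mono k (A ⇒ B) f f' df df' le = Le⇒-intro k A B (down k (A ⇒ B) f) (down k (A ⇒ B) f') (λ g dg →
      subst₂ (Le k B) (sym (ap-down k A B f g)) (sym (ap-down k A B f' g))
        (down-mono k B _ _ (proj₁ (𝒟⇒-monotone (suc k) A B f df) _ (up∈𝒟 g dg))
                           (proj₁ (𝒟⇒-monotone (suc k) A B f' df') _ (up∈𝒟 g dg))
           (Le⇒-elim (suc k) A B f f' le (up k A g) (up∈𝒟 g dg))))
      where
      up∈𝒟 : ∀ g → 𝒟 k A g → 𝒟 (suc k) A (up k A g)
      up∈𝒟 g dg = proj₂ (𝓛⇒𝒟 k A _ _ (𝓛-up k A g dg))

  -- Related arguments pass the guards of the step functions ⟦T⟧ᵏ ⇒ _ and ⟦T⟧ᵏ⁺¹ ⇒ _ together.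
  Le-𝓛-transfer : ∀ k A d d' g₁ g₂ → 𝒟 k A d → 𝓛 k A d d' → Le (suc k) A d' (up k A d) →
                  𝓛 k A g₁ g₂ → leq k A d g₁ ≡ leq (suc k) A d' g₂
  Le-𝓛-transfer k A d d' g₁ g₂ dd l d'≤d↑ r = ≡true-ext to from
    where
    dg₂ = proj₂ (𝓛⇒𝒟 k A g₁ g₂ r)
    g₁≈g₂↓ = 𝓛⇒Eq-down k A g₁ g₂ r
    to : Le k A d g₁ → Le (suc k) A d' g₂
    to d≤g₁ = Le-trans (suc k) A d' (up k A d) g₂ d'≤d↑
      (Le-trans (suc k) A _ _ _
        (up-mono k A d (down k A g₂) dd (proj₁ (𝓛⇒𝒟 k A _ _ (𝓛-down k A g₂ dg₂)))
          (Le-trans k A d g₁ _ d≤g₁ (proj₁ g₁≈g₂↓)))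
        (up-least k A _ _ (𝓛-down k A g₂ dg₂)))
    from : Le (suc k) A d' g₂ → Le k A d g₁
    from d'≤g₂ = Le-trans k A d (down k A (up k A d)) g₁ (proj₁ (𝓛⇒Eq-down k A d _ (𝓛-up k A d dd)))
      (Le-trans k A _ (down k A g₂) g₁
        (down-mono k A _ _ (proj₂ (𝓛⇒𝒟 k A _ _ (𝓛-up k A d dd))) dg₂
          (Le-trans (suc k) A _ d' g₂ (up-least k A d d' l) d'≤g₂))
        (proj₂ g₁≈g₂↓))

  inT⇒rank : ∀ k {A} (t : IT A) → inT k t ≡ true → Σ ℕ (λ l → l ≤ k × inτ l t ≡ true)
  inT⇒rank zero    t h = 0 , z≤n , h
  inT⇒rank (suc k) t h with ∨-elim {inτ (suc k) t} h
  ... | inj₁ t∈τ = suc k , ≤-refl , t∈τ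
  ... | inj₂ t∈𝒯 with inT⇒rank k t t∈𝒯
  ...   | l , l≤k , t∈τₗ = l , m≤n⇒m≤1+n l≤k , t∈τₗ

  rank⇒inT : ∀ k l {A} (t : IT A) → inτ l t ≡ true → l ≤ k → inT k t ≡ true
  rank⇒inT zero .zero t h z≤n = h
  rank⇒inT (suc k) l t h l≤k with m≤n⇒m<n∨m≡n l≤k
  ... | inj₂ refl = ∨-introˡ (inT k t) h
  ... | inj₁ l<k  = ∨-introʳ (inτ (suc k) t) (rank⇒inT k l t h (≤-pred l<k))

  inτ-arr-result : ∀ l {A B} (T : List (IT A)) (s : IT B) → inτ l (arr T s) ≡ true → inτ l s ≡ true
  inτ-arr-result l T s h = ∧-elimʳ {inTs l T} h

  inT-mono : ∀ {l k A} (t : IT A) → l ≤ k → inT l t ≡ true → inT k t ≡ true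
  inT-mono {l} {k} t l≤k h with inT⇒rank l t h
  ... | l' , l'≤l , t∈τ = rank⇒inT k l' t t∈τ (≤-trans l'≤l l≤k)

  inTs⇒All : ∀ k {A} (T : List (IT A)) → inTs k T ≡ true → All (λ t → inT k t ≡ true) T
  inTs⇒All k []      h = []
  inTs⇒All k (t ∷ T) h = ∧-elimˡ h ∷ inTs⇒All k T (∧-elimʳ {inT k t} h)

  inτ-arr-args : ∀ l k {A B} (T : List (IT A)) (s : IT B) → inτ l (arr T s) ≡ true → l ≤ k →
                 All (λ t → inT k t ≡ true) T
  inτ-arr-args l k T s h l≤k = All.map (λ {t} → inT-mono t l≤k) (inTs⇒All l T (∧-elimˡ h))

  lookup-⟦st⟧ : ∀ k q i → lookup (⟦ st q ⟧ k) i ≡ (⌊ i ≟ q ⌋ ∧ (ρ q ≤ᵇ k))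
  lookup-⟦st⟧ k q i = lookup∘tabulate _ i

  ⟦st⟧∈𝒟 : ∀ k q → 𝒟 k o (⟦ st q ⟧ k)
  ⟦st⟧∈𝒟 k q = 𝒟ₒ-intro k (⟦ st q ⟧ k) (λ i h → support i h)
    where
    support : ∀ i → lookup (⟦ st q ⟧ k) i ≡ true → (ρ i ≤ᵇ k) ≡ true
    support i h with i ≟ q | trans (sym (lookup-⟦st⟧ k q i)) h
    ... | yes refl | ρq≤k = ρq≤k

  ⟦st⟧-low≡high∩ : ∀ k q i → (ρ q ≤ᵇ k) ≡ true →
                   lookup (⟦ st q ⟧ k) i ≡ (lookup (⟦ st q ⟧ (suc k)) i ∧ (ρ i ≤ᵇ k))
  ⟦st⟧-low≡high∩ k q i h rewrite lookup-⟦st⟧ k q i | lookup-⟦st⟧ (suc k) q i | h | ≤ᵇ-true-suc (ρ q) k h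
    with i ≟ q
  ... | yes refl rewrite h = refl
  ... | no _ = refl

  bot≡⟦st⟧-high∩ : ∀ k q i → ρ q ≡ suc k →
                   lookup (bot o) i ≡ (lookup (⟦ st q ⟧ (suc k)) i ∧ (ρ i ≤ᵇ k))
  bot≡⟦st⟧-high∩ k q i h rewrite lookup-bot i | lookup-⟦st⟧ (suc k) q i with i ≟ q
  ... | yes refl rewrite h | >⇒≤ᵇ-false {suc k} {k} ≤-refl = sym (∧-zeroʳ _)
  ... | no _ = refl

  if-𝓛 : ∀ k B b b' x y → b ≡ b' → 𝓛 k B x y → 𝓛 k B (if b then x else bot B) (if b' then y else bot B)
  if-𝓛 k B true  .true  x y refl l = l
  if-𝓛 k B false .false x y refl l = 𝓛-bot k B

  if-𝓛-bot : ∀ k B b y → 𝓛 k B (bot B) y → 𝓛 k B (bot B) (if b then y else bot B)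
  if-𝓛-bot k B true  y l = l
  if-𝓛-bot k B false y l = 𝓛-bot k B

  if-Le-up : ∀ k B b b' x y → b ≡ b' → Le (suc k) B y (up k B x) →
             Le (suc k) B (if b' then y else bot B) (up k B (if b then x else bot B))
  if-Le-up k B true  .true  x y refl le = le
  if-Le-up k B false .false x y refl le = bot-least (suc k) B _

  if-Eq-bot : ∀ k B b x → Eq k B x (bot B) → Eq k B (if b then x else bot B) (bot B)
  if-Eq-bot k B true  x e = e
  if-Eq-bot k B false x e = Eq-refl k B _

  ⟦⟧-Eq-bot-above-rank : ∀ k {A} (t : IT A) l → inτ l t ≡ true → k < l → Eq k A (⟦ t ⟧ k) (bot A)
  ⟦⟧-Eq-bot-above-rank k (st q) l h k<l = Eqₒ-intro k (⟦ st q ⟧ k) (bot o) (λ i → begin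
    lookup (⟦ st q ⟧ k) i      ≡⟨ lookup-⟦st⟧ k q i ⟩
    ⌊ i ≟ q ⌋ ∧ (ρ q ≤ᵇ k)     ≡⟨ cong (⌊ i ≟ q ⌋ ∧_) (>⇒≤ᵇ-false (subst (k <_) (sym ρq≡l) k<l)) ⟩
    ⌊ i ≟ q ⌋ ∧ false          ≡⟨ ∧-zeroʳ _ ⟩
    false                      ≡⟨ lookup-bot i ⟨
    lookup (bot o) i           ∎)
    where
    open ≡-Reasoning
    ρq≡l = ≡ᵇ-true⇒≡ (ρ q) l h
  ⟦⟧-Eq-bot-above-rank k (arr {A} {B} T s) l h k<l = Eq⇒-intro k A B (⟦ arr T s ⟧ k) (bot (A ⇒ B)) (λ g _ →
    subst₂ (Eq k B) (sym (ap-step k A B (⟦ T ⟧s k) (⟦ s ⟧ k) g)) (sym (ap-bot A B g))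
      (if-Eq-bot k B _ (⟦ s ⟧ k) (⟦⟧-Eq-bot-above-rank k s l (inτ-arr-result l T s h) k<l)))

  ⟦st⟧-stable : ∀ k q → (ρ q ≤ᵇ k) ≡ true →
                ∀ i → lookup (⟦ st q ⟧ k) i ≡ lookup (⟦ st q ⟧ (suc k)) i
  ⟦st⟧-stable k q h i rewrite lookup-⟦st⟧ k q i | lookup-⟦st⟧ (suc k) q i | h | ≤ᵇ-true-suc (ρ q) k h = refl

  rank-st≤ᵇ : ∀ {k l} q → inτ l (st q) ≡ true → l ≤ k → (ρ q ≤ᵇ k) ≡ true
  rank-st≤ᵇ {k} {l} q h l≤k = ≤⇒≤ᵇ-true (subst (_≤ k) (sym (≡ᵇ-true⇒≡ (ρ q) l h)) l≤k)

  mutual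
    𝒟-⟦⟧-ranked : ∀ k {A} (t : IT A) l → inτ l t ≡ true → l ≤ k → 𝒟 k A (⟦ t ⟧ k)
    𝒟-⟦⟧-ranked k (st q) l h l≤k = ⟦st⟧∈𝒟 k q
    𝒟-⟦⟧-ranked zero (arr {A} {B} T s) l h l≤k = monotone-intro 0 A B (⟦ arr T s ⟧ 0)
      (Monotone-step 0 A B (⟦ T ⟧s 0) (⟦ s ⟧ 0) (𝒟-⟦⟧-ranked 0 s l (inτ-arr-result l T s h) l≤k))
    𝒟-⟦⟧-ranked (suc k) (arr {A} {B} T s) l h l≤k = [
      (λ l<1+k → 𝒟suc⇒-intro k A B (⟦ arr T s ⟧ k) (⟦ arr T s ⟧ (suc k))
                   (𝓛-⟦⟧-ranked k (arr T s) l h (≤-pred l<1+k))) ,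
      (λ l≡1+k → 𝒟suc⇒-intro k A B (bot (A ⇒ B)) (⟦ arr T s ⟧ (suc k))
                   (𝓛-bot-⟦⟧ k (arr T s) (subst (λ l' → inτ l' (arr T s) ≡ true) l≡1+k h))) ]′
      (m≤n⇒m<n∨m≡n l≤k)

    𝒟-⟦⟧s-ranked : ∀ k {A} (T : List (IT A)) → All (λ t → inT k t ≡ true) T → 𝒟 k A (⟦ T ⟧s k)
    𝒟-⟦⟧s-ranked k {A} [] [] = 𝒟-bot k A
    𝒟-⟦⟧s-ranked k {A} (t ∷ T) (p ∷ ps) = let (l , l≤k , h) = inT⇒rank k t p in
      𝒟-join k A (⟦ t ⟧ k) (⟦ T ⟧s k) (𝒟-⟦⟧-ranked k t l h l≤k) (𝒟-⟦⟧s-ranked k T ps)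

    𝓛-⟦⟧-ranked : ∀ k {A} (t : IT A) l → inτ l t ≡ true → l ≤ k →
                  𝓛 k A (⟦ t ⟧ k) (⟦ t ⟧ (suc k))
    𝓛-⟦⟧-ranked k (st q) l h l≤k = 𝓛ₒ-intro k (⟦ st q ⟧ k) (⟦ st q ⟧ (suc k))
      (𝓛ₒ-pair (⟦st⟧∈𝒟 k q) (⟦st⟧∈𝒟 (suc k) q)
               (λ i → ⟦st⟧-low≡high∩ k q i (rank-st≤ᵇ q h l≤k)))
    𝓛-⟦⟧-ranked k (arr {A} {B} T s) l h l≤k = 𝓛⇒-intro k A B (⟦ arr T s ⟧ k) (⟦ arr T s ⟧ (suc k))
      (𝓛⇒-pair (𝒟-⟦⟧-ranked k (arr T s) l h l≤k)
        (Monotone-step (suc k) A B (⟦ T ⟧s (suc k)) (⟦ s ⟧ (suc k))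
          (𝒟-⟦⟧-ranked (suc k) s l (inτ-arr-result l T s h) (m≤n⇒m≤1+n l≤k)))
        (λ g₁ g₂ r → subst₂ (𝓛 k B) (sym (ap-step k A B (⟦ T ⟧s k) (⟦ s ⟧ k) g₁))
                                    (sym (ap-step (suc k) A B (⟦ T ⟧s (suc k)) (⟦ s ⟧ (suc k)) g₂))
          (if-𝓛 k B _ _ (⟦ s ⟧ k) (⟦ s ⟧ (suc k))
            (Le-𝓛-transfer k A (⟦ T ⟧s k) (⟦ T ⟧s (suc k)) g₁ g₂
              (𝒟-⟦⟧s-ranked k T args) (𝓛-⟦⟧s-ranked k T args) (⟦⟧s-ranked-below-up k T args) r)
            (𝓛-⟦⟧-ranked k s l (inτ-arr-result l T s h) l≤k))))
      where
      args = inτ-arr-args l k T s h l≤k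

    𝓛-⟦⟧s-ranked : ∀ k {A} (T : List (IT A)) → All (λ t → inT k t ≡ true) T →
                   𝓛 k A (⟦ T ⟧s k) (⟦ T ⟧s (suc k))
    𝓛-⟦⟧s-ranked k {A} [] [] = 𝓛-bot k A
    𝓛-⟦⟧s-ranked k {A} (t ∷ T) (p ∷ ps) = let (l , l≤k , h) = inT⇒rank k t p in
      𝓛-join k A _ _ _ _ (𝓛-⟦⟧-ranked k t l h l≤k) (𝓛-⟦⟧s-ranked k T ps)

    ⟦⟧-ranked-below-up : ∀ k {A} (t : IT A) l → inτ l t ≡ true → l ≤ k →
                         Le (suc k) A (⟦ t ⟧ (suc k)) (up k A (⟦ t ⟧ k))
    ⟦⟧-ranked-below-up k (st q) l h l≤k =
      proj₂ (Eqₒ-intro (suc k) (⟦ st q ⟧ k) (⟦ st q ⟧ (suc k)) (⟦st⟧-stable k q (rank-st≤ᵇ q h l≤k)))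
    ⟦⟧-ranked-below-up k (arr {A} {B} T s) l h l≤k =
      Le⇒-intro (suc k) A B (⟦ arr T s ⟧ (suc k)) (up k (A ⇒ B) (⟦ arr T s ⟧ k)) (λ g₂ dg₂ →
        subst₂ (Le (suc k) B) (sym (ap-step (suc k) A B (⟦ T ⟧s (suc k)) (⟦ s ⟧ (suc k)) g₂))
          (sym (trans (ap-up k A B (⟦ arr T s ⟧ k) g₂)
                      (cong (up k B) (ap-step k A B (⟦ T ⟧s k) (⟦ s ⟧ k) (down k A g₂)))))
          (if-Le-up k B _ _ (⟦ s ⟧ k) (⟦ s ⟧ (suc k))
            (Le-𝓛-transfer k A (⟦ T ⟧s k) (⟦ T ⟧s (suc k)) (down k A g₂) g₂
              (𝒟-⟦⟧s-ranked k T args) (𝓛-⟦⟧s-ranked k T args) (⟦⟧s-ranked-below-up k T args)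
              (𝓛-down k A g₂ dg₂))
            (⟦⟧-ranked-below-up k s l (inτ-arr-result l T s h) l≤k)))
      where
      args = inτ-arr-args l k T s h l≤k

    ⟦⟧s-ranked-below-up : ∀ k {A} (T : List (IT A)) → All (λ t → inT k t ≡ true) T →
                          Le (suc k) A (⟦ T ⟧s (suc k)) (up k A (⟦ T ⟧s k))
    ⟦⟧s-ranked-below-up k {A} [] [] = bot-least (suc k) A _
    ⟦⟧s-ranked-below-up k {A} (t ∷ T) (p ∷ ps) = let (l , l≤k , h) = inT⇒rank k t p in
      join-least (suc k) A (⟦ t ⟧ (suc k)) (⟦ T ⟧s (suc k)) _
        (Le-trans (suc k) A _ _ _ (⟦⟧-ranked-below-up k t l h l≤k)
          (up-mono k A _ _ (𝒟-⟦⟧-ranked k t l h l≤k) t∨T∈𝒟 (join-upperˡ k A (⟦ t ⟧ k) (⟦ T ⟧s k))))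
        (Le-trans (suc k) A _ _ _ (⟦⟧s-ranked-below-up k T ps)
          (up-mono k A _ _ (𝒟-⟦⟧s-ranked k T ps) t∨T∈𝒟 (join-upperʳ k A (⟦ t ⟧ k) (⟦ T ⟧s k))))
      where
      t∨T∈𝒟 = 𝒟-⟦⟧s-ranked k (t ∷ T) (p ∷ ps)

    𝓛-bot-⟦⟧ : ∀ k {A} (t : IT A) → inτ (suc k) t ≡ true → 𝓛 k A (bot A) (⟦ t ⟧ (suc k))
    𝓛-bot-⟦⟧ k (st q) h = 𝓛ₒ-intro k (bot o) (⟦ st q ⟧ (suc k))
      (𝓛ₒ-pair (𝒟-bot k o) (⟦st⟧∈𝒟 (suc k) q)
               (λ i → bot≡⟦st⟧-high∩ k q i (≡ᵇ-true⇒≡ (ρ q) (suc k) h)))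
    𝓛-bot-⟦⟧ k (arr {A} {B} T s) h = 𝓛⇒-intro k A B (bot (A ⇒ B)) (⟦ arr T s ⟧ (suc k))
      (𝓛⇒-pair (𝒟-bot k (A ⇒ B))
        (Monotone-step (suc k) A B (⟦ T ⟧s (suc k)) (⟦ s ⟧ (suc k))
          (𝒟-⟦⟧-ranked (suc k) s (suc k) (inτ-arr-result (suc k) T s h) ≤-refl))
        (λ g₁ g₂ r → subst₂ (𝓛 k B) (sym (ap-bot A B g₁))
                                    (sym (ap-step (suc k) A B (⟦ T ⟧s (suc k)) (⟦ s ⟧ (suc k)) g₂))
          (if-𝓛-bot k B _ (⟦ s ⟧ (suc k)) (𝓛-bot-⟦⟧ k s (inτ-arr-result (suc k) T s h)))))

  ¬inT⇒above-rank : ∀ k l {A} (t : IT A) → inT k t ≡ false → inτ l t ≡ true → k < l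
  ¬inT⇒above-rank k l t ¬t∈𝒯 h with l ≤? k
  ... | no l≰k = ≰⇒> l≰k
  ... | yes l≤k with () ← trans (sym ¬t∈𝒯) (rank⇒inT k l t h l≤k)

  𝒟-⟦⟧ : ∀ k {A} (t : IT A) l → inτ l t ≡ true → 𝒟 k A (⟦ t ⟧ k)
  𝒟-⟦⟧ k {A} t l h with l ≤? k
  ... | yes l≤k = 𝒟-⟦⟧-ranked k t l h l≤k
  ... | no  l≰k = 𝒟-resp-Eq k A (bot A) (𝒟-bot k A) (⟦ t ⟧ k)
                    (Eq-sym k A _ _ (⟦⟧-Eq-bot-above-rank k t l h (≰⇒> l≰k)))

  𝓛-⟦⟧ : ∀ k {A} (t : IT A) l → inτ l t ≡ true → 𝓛 k A (⟦ t ⟧ k) (⟦ t ⟧ (suc k))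
  𝓛-⟦⟧ k {A} t l h with l ≤? k
  ... | yes l≤k = 𝓛-⟦⟧-ranked k t l h l≤k
  ... | no  l≰k with m≤n⇒m<n∨m≡n (≰⇒> l≰k)
  ...   | inj₂ refl = 𝓛-respˡ-Eq k A (bot A) (⟦ t ⟧ (suc k)) (𝓛-bot-⟦⟧ k t h) (⟦ t ⟧ k)
                        (Eq-sym k A _ _ (⟦⟧-Eq-bot-above-rank k t l h (≰⇒> l≰k))) (𝒟-⟦⟧ k t l h)
  ...   | inj₁ 1+k<l = 𝓛-respʳ-Eq k A (⟦ t ⟧ k) (bot A)
                         (𝓛-respˡ-Eq k A (bot A) (bot A) (𝓛-bot k A) (⟦ t ⟧ k)
                           (Eq-sym k A _ _ (⟦⟧-Eq-bot-above-rank k t l h (≰⇒> l≰k))) (𝒟-⟦⟧ k t l h))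
                         (⟦ t ⟧ (suc k)) (Eq-sym (suc k) A _ _ (⟦⟧-Eq-bot-above-rank (suc k) t l h 1+k<l))
                         (𝒟-⟦⟧ (suc k) t l h)

  𝒟-⟦⟧s : ∀ m k {A} (S : List (IT A)) → All (λ t → inT m t ≡ true) S → 𝒟 k A (⟦ S ⟧s k)
  𝒟-⟦⟧s m k {A} [] [] = 𝒟-bot k A
  𝒟-⟦⟧s m k {A} (t ∷ S) (p ∷ ps) = let (l , _ , h) = inT⇒rank m t p in
    𝒟-join k A _ _ (𝒟-⟦⟧ k t l h) (𝒟-⟦⟧s m k S ps)

  𝓛-⟦⟧s : ∀ m k {A} (S : List (IT A)) → All (λ t → inT m t ≡ true) S →
          𝓛 k A (⟦ S ⟧s k) (⟦ S ⟧s (suc k))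
  𝓛-⟦⟧s m k {A} [] [] = 𝓛-bot k A
  𝓛-⟦⟧s m k {A} (t ∷ S) (p ∷ ps) = let (l , _ , h) = inT⇒rank m t p in
    𝓛-join k A _ _ _ _ (𝓛-⟦⟧ k t l h) (𝓛-⟦⟧s m k S ps)

  cap-inT : ∀ k {A} (S : List (IT A)) → All (λ t → inT k t ≡ true) (cap k S)
  cap-inT k [] = []
  cap-inT k (t ∷ S) with inT k t in t∈𝒯
  ... | true  = t∈𝒯 ∷ cap-inT k S
  ... | false = cap-inT k S

  ⟦⟧s-Eq-⟦cap⟧s : ∀ m k {A} (S : List (IT A)) → All (λ t → inT m t ≡ true) S →
                  Eq k A (⟦ S ⟧s k) (⟦ cap k S ⟧s k)
  ⟦⟧s-Eq-⟦cap⟧s m k {A} [] [] = Eq-refl k A _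
  ⟦⟧s-Eq-⟦cap⟧s m k {A} (t ∷ S) (p ∷ ps) with inT k t in t∈𝒯
  ... | true  = join-cong k A _ _ _ _ (Eq-refl k A _) (⟦⟧s-Eq-⟦cap⟧s m k S ps)
  ... | false = let (l , _ , h) = inT⇒rank m t p in
    Eq-trans k A _ _ _
      (join-cong k A _ _ _ _ (⟦⟧-Eq-bot-above-rank k t l h (¬inT⇒above-rank k l t t∈𝒯 h)) (Eq-refl k A _))
      (Eq-trans k A _ _ _ (join-identityˡ k A _) (⟦⟧s-Eq-⟦cap⟧s m k S ps))

  𝓛⇒IsDown : ∀ k A d e → 𝓛 k A d e → IsDown k A d e
  𝓛⇒IsDown k A d e l = l , λ d' l' →
    let d'≈d = Eq-trans k A d' _ d (𝓛⇒Eq-down k A d' e l') (Eq-sym k A d _ (𝓛⇒Eq-down k A d e l))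
    in ∧-intro (proj₁ d'≈d) (proj₂ d'≈d)

  ⟦cap⟧s-IsUpBot : ∀ m k {A} (S : List (IT A)) → All (λ t → inT m t ≡ true) S →
                   IsUpBot k A (⟦ S ⟧s k) (⟦ cap k S ⟧s (suc k))
  ⟦cap⟧s-IsUpBot m k {A} S S⊆𝒯 =
    𝓛-respˡ-Eq k A d₀ e (𝓛-⟦⟧s-ranked k (cap k S) cap⊆𝒯ᵏ) d (Eq-sym k A d d₀ d≈d₀) d∈𝒟 ,
    λ e' l' → Le-trans (suc k) A e (up k A d₀) e' (⟦⟧s-ranked-below-up k (cap k S) cap⊆𝒯ᵏ)
      (Le-trans (suc k) A (up k A d₀) (up k A d) e'
        (up-mono k A d₀ d (𝒟-⟦⟧s-ranked k (cap k S) cap⊆𝒯ᵏ) d∈𝒟 (proj₂ d≈d₀))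
        (up-least k A d e' l'))
    where
    d = ⟦ S ⟧s k
    d₀ = ⟦ cap k S ⟧s k
    e = ⟦ cap k S ⟧s (suc k)
    cap⊆𝒯ᵏ = cap-inT k S
    d≈d₀ = ⟦⟧s-Eq-⟦cap⟧s m k S S⊆𝒯
    d∈𝒟 = 𝒟-⟦⟧s m k S S⊆𝒯

lemma5p1 : (n : ℕ) (ρ : Fin n → ℕ) (m : ℕ) →
           (∀ q → ρ q ≤ m) → ∃ (λ q → ρ q ≡ m) →
           let open Model n ρ in
           (A : Ty) (S : List (IT A)) → All (λ t → inT m t ≡ true) S →
           (k : ℕ) → k ≤ m →
           (eqD k A (⟦ S ⟧s k) (⟦ cap k S ⟧s k) ≡ true)
           × (k < m →
                IsUpBot k A (⟦ S ⟧s k) (⟦ cap k S ⟧s (suc k))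
                × IsDown k A (⟦ S ⟧s k) (⟦ S ⟧s (suc k)))
lemma5p1 n ρ m _ _ A S S⊆𝒯 k _ =
  ∧-intro (proj₁ S≈cap) (proj₂ S≈cap) ,
  λ _ → ⟦cap⟧s-IsUpBot m k S S⊆𝒯 ,
        𝓛⇒IsDown k A (⟦ S ⟧s k) (⟦ S ⟧s (suc k)) (𝓛-⟦⟧s m k S S⊆𝒯)
  where
  open Semantics n ρ
  S≈cap = ⟦⟧s-Eq-⟦cap⟧s m k S S⊆𝒯
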